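{- Every permutation in $\operatorname{Av}(2143,4312)$ belongs to the monotone grid class with 2 columns and 2 rows whose cells, written as (column, row), are: $(1,1)$ increasing, $(1,2)$ increasing, $(2,2)$ increasing, and $(2,1)$ decreasing.
   Context: Pattern containment: $\pi$ contains $\sigma$ if some subsequence of $\pi$ is order-isomorphic to $\sigma$; $\operatorname{Av}(B)$ is the set of permutations containing no element of $B$. Monotone grid class: columns numbered left to right, rows bottom to top; a permutation $\pi$ of length $n$ belongs to the class if there are $0=c_0\le c_1\le c_2=n$ and $0=r_0\le r_1\le r_2=n$ such that for each cell $(i,j)$ the points $(p,\pi(p))$ with $c_{i-1}<p\le c_i$, $r_{j-1}<\pi(p)\le r_j$ form an increasing (resp. decreasing) sequence, possibly empty, when the cell is increasing (resp. decreasing). -}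

module Defs where

open import Data.Nat using (ℕ; _<_; _≤_)
open import Data.Fin using (Fin; toℕ; zero; suc) renaming (_<_ to _<ᶠ_)
open import Data.Product using (Σ; _×_)
open import Function using (Bijective; _⇔_)
open import Relation.Binary.PropositionalEquality using (_≡_)
open import Relation.Nullary using (¬_)

-- A permutation of length n: a bijection of Fin n.  Positions and values are
-- 0-indexed: the point (p, π p) here is the point (p+1, π(p)+1) of the paper.
record Perm (n : ℕ) : Set where
  field
    fun       : Fin n → Fin n
    bijective : Bijective _≡_ _≡_ fun
open Perm public

StrictlyIncreasing : ∀ {k n} → (Fin k → Fin n) → Set
StrictlyIncreasing e = ∀ i j → i <ᶠ j → e i <ᶠ e j

Contains : ∀ {n k} → Perm n → (Fin k → Fin k) → Set
Contains {n} {k} π σ =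
  Σ (Fin k → Fin n) λ e → StrictlyIncreasing e ×
    (∀ i j → (fun π (e i) <ᶠ fun π (e j)) ⇔ (σ i <ᶠ σ j))

-- Patterns 2143 and 4312 in 0-indexed one-line notation
p2143 : Fin 4 → Fin 4
p2143 zero = suc zero
p2143 (suc zero) = zero
p2143 (suc (suc zero)) = suc (suc (suc zero))
p2143 (suc (suc (suc zero))) = suc (suc zero)

p4312 : Fin 4 → Fin 4
p4312 zero = suc (suc (suc zero))
p4312 (suc zero) = suc (suc zero)
p4312 (suc (suc zero)) = zero
p4312 (suc (suc (suc zero))) = suc zero

InAv2143-4312 : ∀ {n} → Perm n → Set
InAv2143-4312 π = ¬ Contains π p2143 × ¬ Contains π p4312

-- Index x (0-indexed) lies in part 1 (first column / bottom row) w.r.t. the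
-- divider d iff x+1 ≤ d, i.e. toℕ x < d; otherwise in part 2.
InPart : ℕ → ∀ {n} → Fin 2 → Fin n → Set
InPart d zero x = toℕ x < d
InPart d (suc zero) x = d ≤ toℕ x

InCell : ∀ {n} → Perm n → ℕ → ℕ → Fin 2 → Fin 2 → Fin n → Set
InCell π c r i j p = InPart c i p × InPart r j (fun π p)

data CellType : Set where
  increasing decreasing : CellType

CellOK : ∀ {n} → Perm n → ℕ → ℕ → Fin 2 → Fin 2 → CellType → Set
CellOK π c r i j increasing =
  ∀ p q → InCell π c r i j p → InCell π c r i j q → p <ᶠ q → fun π p <ᶠ fun π q
CellOK π c r i j decreasing =
  ∀ p q → InCell π c r i j p → InCell π c r i j q → p <ᶠ q → fun π q <ᶠ fun π p

-- Monotone grid class with 2 columns and 2 rows; M i j is the type of the cell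
-- in column i+1, row j+1.
InGrid2x2 : (Fin 2 → Fin 2 → CellType) → ∀ {n} → Perm n → Set
InGrid2x2 M {n} π =
  Σ ℕ λ c → Σ ℕ λ r → c ≤ n × r ≤ n ×
    (∀ i j → CellOK π c r i j (M i j))

M₄₂ : Fin 2 → Fin 2 → CellType
M₄₂ zero zero = increasing
M₄₂ zero (suc zero) = increasing
M₄₂ (suc zero) (suc zero) = increasing
M₄₂ (suc zero) zero = decreasing

-- Cut the columns before the longest suffix of π avoiding 132 and 312, and the
-- rows just above the highest lower point of an inversion lying inside one
-- column; the two top cells are then increasing by construction.  Every
-- position k left of the cut is followed by a 132 or 312 starting at k or later,
-- which would complete a 321 or 2413 ending at k into a 2143 or 4312, so the
-- left column avoids 321 and 2413.  From this, the lower point of an inversion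
-- inside a column lies below the upper point of every inversion of the left
-- column and of every ascent of the right column.  Those upper points are thus
-- in the top row, so the bottom left cell is increasing and the bottom right
-- cell decreasing.
module Submission where

open import Defs
open import Data.Nat using (ℕ; zero; suc; _≤_; _<_; z≤n; s≤s⁻¹; _≤?_)
open import Data.Nat.Properties
  using (≤-refl; ≤-trans; <-trans; <-irrefl; <-asym; ≤-<-trans; <-≤-trans; m≤n⇒m≤1+n; ≮⇒≥; ≰⇒>; <⇒≤; <⇒≱)
open import Data.Fin using (Fin; toℕ; zero; suc) renaming (_<_ to _<ᶠ_)
import Data.Fin.Properties as Fin
open import Data.List using (List; []; _∷_; lookup)
open import Data.List.Relation.Unary.Linked as Linked using (Linked; []; [-]; _∷_)
open import Data.Product using (∃; _×_; _,_; proj₁)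
open import Data.Sum using (_⊎_; inj₁; inj₂; [_,_])
open import Data.Empty using (⊥; ⊥-elim)
open import Function using (id; _∘_; _on_; mk⇔)
open import Level using (Level)
open import Relation.Binary using (Rel; Transitive; Tri; tri<; tri≈; tri>)
open import Relation.Binary.PropositionalEquality
  using (_≡_; _≢_; refl; cong; ≢-sym; module ≡-Reasoning)
open import Relation.Nullary using (¬_; Dec; yes; no)
open import Relation.Nullary.Decidable using (_×-dec_; _⊎-dec_)
open import Relation.Unary using (Decidable)

private
  variable
    p ℓ : Level

record Threshold (P : ℕ → Set p) (n : ℕ) : Set p where
  field
    point     : ℕ
    point≤n   : point ≤ n
    ¬P[point] : ¬ P point
    P[<point] : ∀ {k} → k < point → P k

threshold : {P : ℕ → Set p} → Decidable P → (∀ {j k} → j ≤ k → P k → P j) →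
            ∀ {n} → ¬ P n → Threshold P n
threshold P? closed {zero} ¬P[n] = record
  { point = 0 ; point≤n = z≤n ; ¬P[point] = ¬P[n] ; P[<point] = λ () }
threshold P? closed {suc n} ¬P[1+n] with P? n
... | yes P[n] = record
  { point = suc n ; point≤n = ≤-refl ; ¬P[point] = ¬P[1+n]
  ; P[<point] = λ k<1+n → closed (s≤s⁻¹ k<1+n) P[n] }
... | no ¬P[n] = record
  { point = point ; point≤n = m≤n⇒m≤1+n point≤n
  ; ¬P[point] = ¬P[point] ; P[<point] = P[<point] }
  where open Threshold (threshold P? closed ¬P[n])

lookup-increasing : ∀ {A : Set p} {R : Rel A ℓ} → Transitive R → ∀ {xs} → Linked R xs →
                    ∀ i j → i <ᶠ j → R (lookup xs i) (lookup xs j)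
lookup-increasing R-trans {_ ∷ _} xs↗ zero (suc j) _ =
  Linked.lookup R-trans (Linked.tail xs↗) (Linked.head′ xs↗) j
lookup-increasing R-trans {_ ∷ _} xs↗ (suc i) (suc j) i<j =
  lookup-increasing R-trans (Linked.tail xs↗) i j (s≤s⁻¹ i<j)

-- v lists the points of e by increasing value, so the i-th point has value rank σ i.
contains-via-value-order : ∀ {n k} (π : Perm n) (σ : Fin k → Fin k) {e v : Fin k → Fin n} →
                           StrictlyIncreasing e → StrictlyIncreasing (fun π ∘ v) →
                           (∀ i → e i ≡ v (σ i)) → Contains π σ
contains-via-value-order π σ {e} {v} e↗ πv↗ e≡vσ =
  e , e↗ , λ i j → mk⇔ (reflect i j) (preserve i j)
  where
  preserve : ∀ i j → σ i <ᶠ σ j → fun π (e i) <ᶠ fun π (e j)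
  preserve i j σi<σj rewrite e≡vσ i | e≡vσ j = πv↗ (σ i) (σ j) σi<σj

  reflect : ∀ i j → fun π (e i) <ᶠ fun π (e j) → σ i <ᶠ σ j
  reflect i j πei<πej with Fin.<-cmp (σ i) (σ j)
  ... | tri< σi<σj _ _ = σi<σj
  ... | tri≈ _ σi≡σj _ = ⊥-elim (Fin.<⇒≢ πei<πej (cong (fun π) ei≡ej))
    where
    open ≡-Reasoning
    ei≡ej : e i ≡ e j
    ei≡ej = begin
      e i     ≡⟨ e≡vσ i ⟩
      v (σ i) ≡⟨ cong v σi≡σj ⟩
      v (σ j) ≡⟨ e≡vσ j ⟨
      e j     ∎
  ... | tri> _ _ σj<σi = ⊥-elim (<-asym πei<πej (preserve j i σj<σi))

≢⇒<⊎> : ∀ {n} {x y : Fin n} → x ≢ y → x <ᶠ y ⊎ y <ᶠ x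
≢⇒<⊎> {x = x} {y} x≢y with Fin.<-cmp x y
... | tri< x<y _ _ = inj₁ x<y
... | tri≈ _ x≡y _ = ⊥-elim (x≢y x≡y)
... | tri> _ _ y<x = inj₂ y<x

module Avoiding {n} (π : Perm n)
                (avoids-2143 : ¬ Contains π p2143) (avoids-4312 : ¬ Contains π p4312) where

  _<ᵛ_ : Rel (Fin n) _
  _<ᵛ_ = _<ᶠ_ on fun π

  _<ᵛ?_ : ∀ x y → Dec (x <ᵛ y)
  x <ᵛ? y = fun π x Fin.<? fun π y

  <ᵛ⇒≢ : ∀ {x y} → x <ᵛ y → x ≢ y
  <ᵛ⇒≢ x<y refl = <-irrefl refl x<y

  values-differ : ∀ {x y} → x <ᶠ y → x <ᵛ y ⊎ y <ᵛ x
  values-differ x<y = ≢⇒<⊎> (Fin.<⇒≢ x<y ∘ proj₁ (bijective π))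

  positions-differ : ∀ {x y} → x <ᵛ y → x <ᶠ y ⊎ y <ᶠ x
  positions-differ = ≢⇒<⊎> ∘ <ᵛ⇒≢

  positions↗ : ∀ {xs : List (Fin n)} → Linked _<ᶠ_ xs → StrictlyIncreasing (lookup xs)
  positions↗ = lookup-increasing <-trans

  values↗ : ∀ {xs : List (Fin n)} → Linked _<ᵛ_ xs → StrictlyIncreasing (fun π ∘ lookup xs)
  values↗ = lookup-increasing <-trans

  no-2143 : ∀ {a b c d} → a <ᶠ b → b <ᶠ c → c <ᶠ d → b <ᵛ a → a <ᵛ d → d <ᵛ c → ⊥
  no-2143 {a} {b} {c} {d} a<b b<c c<d b<ᵛa a<ᵛd d<ᵛc = avoids-2143
    (contains-via-value-order π p2143
      {lookup (a ∷ b ∷ c ∷ d ∷ [])} {lookup (b ∷ a ∷ d ∷ c ∷ [])}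
      (positions↗ (a<b ∷ b<c ∷ c<d ∷ [-]))
      (values↗ (b<ᵛa ∷ a<ᵛd ∷ d<ᵛc ∷ [-]))
      λ { zero → refl ; (suc zero) → refl ; (suc (suc zero)) → refl
        ; (suc (suc (suc zero))) → refl })

  no-4312 : ∀ {a b c d} → a <ᶠ b → b <ᶠ c → c <ᶠ d → c <ᵛ d → d <ᵛ b → b <ᵛ a → ⊥
  no-4312 {a} {b} {c} {d} a<b b<c c<d c<ᵛd d<ᵛb b<ᵛa = avoids-4312
    (contains-via-value-order π p4312
      {lookup (a ∷ b ∷ c ∷ d ∷ [])} {lookup (c ∷ d ∷ b ∷ a ∷ [])}
      (positions↗ (a<b ∷ b<c ∷ c<d ∷ [-]))
      (values↗ (c<ᵛd ∷ d<ᵛb ∷ b<ᵛa ∷ [-]))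
      λ { zero → refl ; (suc zero) → refl ; (suc (suc zero)) → refl
        ; (suc (suc (suc zero))) → refl })

  Forms132or312 : Fin n → Fin n → Fin n → Set
  Forms132or312 x y z = x <ᶠ y × y <ᶠ z × ((x <ᵛ z × z <ᵛ y) ⊎ (y <ᵛ z × z <ᵛ x))

  Has132or312From : ℕ → Set
  Has132or312From k = ∃ λ x → ∃ λ y → ∃ λ z → k ≤ toℕ x × Forms132or312 x y z

  has132or312From? : Decidable Has132or312From
  has132or312From? k = Fin.any? λ x → Fin.any? λ y → Fin.any? λ z → (k ≤? toℕ x) ×-dec
    (x Fin.<? y ×-dec y Fin.<? z ×-dec
     ((x <ᵛ? z ×-dec z <ᵛ? y) ⊎-dec (y <ᵛ? z ×-dec z <ᵛ? x)))

  column : Threshold Has132or312From n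
  column = threshold has132or312From?
    (λ { j≤k (x , y , z , k≤x , xyz) → x , y , z , ≤-trans j≤k k≤x , xyz })
    (λ { (x , _ , _ , n≤x , _) → <-irrefl refl (<-≤-trans (Fin.toℕ<n x) n≤x) })

  open Threshold column using ()
    renaming ( point to c ; point≤n to c≤n
             ; ¬P[point] to right-avoids-132-312 ; P[<point] to 132or312-after )

  left-avoids-321 : ∀ {i j k} → i <ᶠ j → j <ᶠ k → toℕ k < c → k <ᵛ j → j <ᵛ i → ⊥
  left-avoids-321 {i} {j} {k} i<j j<k k<c k<ᵛj j<ᵛi with 132or312-after k<c
  ... | x , y , z , k≤x , x<y , y<z , shape = complete shape (values-differ j<z)
    where
    j<z : j <ᶠ z
    j<z = <-trans j<k (≤-<-trans k≤x (<-trans x<y y<z))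

    complete : (x <ᵛ z × z <ᵛ y) ⊎ (y <ᵛ z × z <ᵛ x) → j <ᵛ z ⊎ z <ᵛ j → ⊥
    complete (inj₁ (x<ᵛz , z<ᵛy)) (inj₁ j<ᵛz) = no-2143 j<k (≤-<-trans k≤x x<y) y<z k<ᵛj j<ᵛz z<ᵛy
    complete (inj₁ (x<ᵛz , z<ᵛy)) (inj₂ z<ᵛj) =
      no-4312 i<j (<-≤-trans j<k k≤x) (<-trans x<y y<z) x<ᵛz z<ᵛj j<ᵛi
    complete (inj₂ (y<ᵛz , z<ᵛx)) (inj₁ j<ᵛz) =
      no-2143 j<k (Fin.≤∧≢⇒< k≤x (<ᵛ⇒≢ (<-trans k<ᵛj (<-trans j<ᵛz z<ᵛx))))
              (<-trans x<y y<z) k<ᵛj j<ᵛz z<ᵛx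
    complete (inj₂ (y<ᵛz , z<ᵛx)) (inj₂ z<ᵛj) =
      no-4312 i<j (<-trans j<k (≤-<-trans k≤x x<y)) y<z y<ᵛz z<ᵛj j<ᵛi

  left-avoids-2413 : ∀ {p a q b} → p <ᶠ a → a <ᶠ q → q <ᶠ b → toℕ b < c →
                     q <ᵛ p → p <ᵛ b → b <ᵛ a → ⊥
  left-avoids-2413 {p} {a} {q} {b} p<a a<q q<b b<c q<ᵛp p<ᵛb b<ᵛa with 132or312-after b<c
  ... | x , y , z , b≤x , x<y , y<z , shape = complete shape (values-differ p<z)
    where
    p<z : p <ᶠ z
    p<z = <-trans (<-trans p<a (<-trans a<q q<b)) (≤-<-trans b≤x (<-trans x<y y<z))

    complete : (x <ᵛ z × z <ᵛ y) ⊎ (y <ᵛ z × z <ᵛ x) → p <ᵛ z ⊎ z <ᵛ p → ⊥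
    complete (inj₁ (x<ᵛz , z<ᵛy)) (inj₁ p<ᵛz) =
      no-2143 (<-trans p<a a<q) (<-trans q<b (≤-<-trans b≤x x<y)) y<z q<ᵛp p<ᵛz z<ᵛy
    complete (inj₁ (x<ᵛz , z<ᵛy)) (inj₂ z<ᵛp) =
      no-4312 (<-trans a<q q<b) (Fin.≤∧≢⇒< b≤x (≢-sym (<ᵛ⇒≢ (<-trans x<ᵛz z<ᵛb))))
              (<-trans x<y y<z) x<ᵛz z<ᵛb b<ᵛa
      where
      z<ᵛb : z <ᵛ b
      z<ᵛb = <-trans z<ᵛp p<ᵛb
    complete (inj₂ (y<ᵛz , z<ᵛx)) (inj₁ p<ᵛz) =
      no-2143 (<-trans p<a a<q) (<-≤-trans q<b b≤x) (<-trans x<y y<z) q<ᵛp p<ᵛz z<ᵛx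
    complete (inj₂ (y<ᵛz , z<ᵛx)) (inj₂ z<ᵛp) =
      no-4312 (<-trans a<q q<b) (≤-<-trans b≤x x<y) y<z y<ᵛz (<-trans z<ᵛp p<ᵛb) b<ᵛa

  SameColumn : Fin n → Fin n → Set
  SameColumn a b = toℕ b < c ⊎ c ≤ toℕ a

  ColumnInversion : Fin n → Fin n → Set
  ColumnInversion a b = a <ᶠ b × b <ᵛ a × SameColumn a b

  HasColumnInversionFrom : ℕ → Set
  HasColumnInversionFrom v = ∃ λ a → ∃ λ b → ColumnInversion a b × v ≤ toℕ (fun π b)

  hasColumnInversionFrom? : Decidable HasColumnInversionFrom
  hasColumnInversionFrom? v = Fin.any? λ a → Fin.any? λ b →
    (a Fin.<? b ×-dec b <ᵛ? a ×-dec (suc (toℕ b) ≤? c ⊎-dec c ≤? toℕ a))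
    ×-dec v ≤? toℕ (fun π b)

  row : Threshold HasColumnInversionFrom n
  row = threshold hasColumnInversionFrom?
    (λ { j≤k (a , b , ab , k≤b) → a , b , ab , ≤-trans j≤k k≤b })
    (λ { (_ , b , _ , n≤b) → <-irrefl refl (<-≤-trans (Fin.toℕ<n (fun π b)) n≤b) })

  open Threshold row using ()
    renaming ( point to r ; point≤n to r≤n
             ; ¬P[point] to no-inversion-from-r ; P[<point] to inversion-from-below-r )

  inversion-below-r : ∀ {a b} → ColumnInversion a b → toℕ (fun π b) < r
  inversion-below-r {a} {b} ab = ≰⇒> λ r≤b → no-inversion-from-r (a , b , ab , r≤b)

  r-minimal : ∀ {u} → (∀ {a b} → ColumnInversion a b → toℕ (fun π b) < u) → r ≤ u
  r-minimal bound = ≮⇒≥ λ u<r → let (_ , _ , ab , u≤b) = inversion-from-below-r u<r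
                                in <⇒≱ (bound ab) u≤b

  no-stacked-left-inversions : ∀ {a b p q} → a <ᶠ b → toℕ b < c → b <ᵛ a →
                               p <ᶠ q → toℕ q < c → q <ᵛ p → p <ᵛ b → ⊥
  no-stacked-left-inversions a<b b<c b<ᵛa p<q q<c q<ᵛp p<ᵛb
    with positions-differ (<-trans p<ᵛb b<ᵛa)
  ... | inj₂ a<p = left-avoids-321 a<p p<q q<c q<ᵛp (<-trans p<ᵛb b<ᵛa)
  ... | inj₁ p<a with positions-differ (<-trans q<ᵛp p<ᵛb)
  ...   | inj₂ b<q = left-avoids-321 a<b b<q q<c (<-trans q<ᵛp p<ᵛb) b<ᵛa
  ...   | inj₁ q<b with positions-differ (<-trans q<ᵛp (<-trans p<ᵛb b<ᵛa))
  ...     | inj₁ q<a = no-2143 p<q q<a a<b q<ᵛp p<ᵛb b<ᵛa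
  ...     | inj₂ a<q = left-avoids-2413 p<a a<q q<b b<c q<ᵛp p<ᵛb b<ᵛa

  below-left-inversion : ∀ {a b p q} → ColumnInversion a b → p <ᶠ q → toℕ q < c → q <ᵛ p → b <ᵛ p
  below-left-inversion {b = b} {p} (a<b , b<ᵛa , inj₁ b<c) p<q q<c q<ᵛp
    with Fin.<-cmp (fun π b) (fun π p)
  ... | tri< b<ᵛp _ _ = b<ᵛp
  ... | tri> _ _ p<ᵛb = ⊥-elim (no-stacked-left-inversions a<b b<c b<ᵛa p<q q<c q<ᵛp p<ᵛb)
  ... | tri≈ _ πb≡πp _ with proj₁ (bijective π) πb≡πp
  ...   | refl = ⊥-elim (left-avoids-321 a<b p<q q<c q<ᵛp b<ᵛa)
  below-left-inversion (a<b , b<ᵛa , inj₂ c≤a) p<q q<c q<ᵛp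
    with values-differ (<-trans p<q (<-≤-trans q<c (≤-trans c≤a (<⇒≤ a<b))))
  ... | inj₁ p<ᵛb = ⊥-elim (no-2143 p<q (<-≤-trans q<c c≤a) a<b q<ᵛp p<ᵛb b<ᵛa)
  ... | inj₂ b<ᵛp = b<ᵛp

  below-right-ascent : ∀ {a b p q} → ColumnInversion a b → p <ᶠ q → c ≤ toℕ p → p <ᵛ q → b <ᵛ q
  below-right-ascent (a<b , b<ᵛa , inj₁ b<c) p<q c≤p p<ᵛq
    with values-differ (<-≤-trans b<c (≤-trans c≤p (<⇒≤ p<q)))
  ... | inj₁ b<ᵛq = b<ᵛq
  ... | inj₂ q<ᵛb = ⊥-elim (no-4312 a<b (<-≤-trans b<c c≤p) p<q p<ᵛq q<ᵛb b<ᵛa)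
  below-right-ascent {a} {b} {p} {q} (a<b , b<ᵛa , inj₂ c≤a) p<q c≤p p<ᵛq with b <ᵛ? q
  ... | yes b<ᵛq = b<ᵛq
  ... | no b≮ᵛq = ⊥-elim (by-position (Fin.<-cmp p a))
    where
    q≤ᵛb : toℕ (fun π q) ≤ toℕ (fun π b)
    q≤ᵛb = ≮⇒≥ b≮ᵛq

    by-position : Tri (p <ᶠ a) (p ≡ a) (a <ᶠ p) → ⊥
    by-position (tri< p<a _ _) =
      right-avoids-132-312 (p , a , b , c≤p , p<a , a<b , inj₁ (<-≤-trans p<ᵛq q≤ᵛb , b<ᵛa))
    by-position (tri≈ _ refl _) = <-asym p<ᵛq (≤-<-trans q≤ᵛb b<ᵛa)
    by-position (tri> _ _ a<p) =
      right-avoids-132-312 (a , p , q , c≤a , a<p , p<q , inj₂ (p<ᵛq , ≤-<-trans q≤ᵛb b<ᵛa))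

  left-inversion-top : ∀ {p q} → p <ᶠ q → toℕ q < c → q <ᵛ p → r ≤ toℕ (fun π p)
  left-inversion-top p<q q<c q<ᵛp = r-minimal λ ab → below-left-inversion ab p<q q<c q<ᵛp

  right-ascent-top : ∀ {p q} → p <ᶠ q → c ≤ toℕ p → p <ᵛ q → r ≤ toℕ (fun π q)
  right-ascent-top p<q c≤p p<ᵛq = r-minimal λ ab → below-right-ascent ab p<q c≤p p<ᵛq

  ascent-unless : ∀ {p q} → p <ᶠ q → ¬ q <ᵛ p → p <ᵛ q
  ascent-unless p<q q≮ᵛp = [ id , ⊥-elim ∘ q≮ᵛp ] (values-differ p<q)

  descent-unless : ∀ {p q} → p <ᶠ q → ¬ p <ᵛ q → q <ᵛ p
  descent-unless p<q p≮ᵛq = [ ⊥-elim ∘ p≮ᵛq , id ] (values-differ p<q)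

  cells : ∀ i j → CellOK π c r i j (M₄₂ i j)
  cells zero zero p q (_ , p<r) (q<c , _) p<q =
    ascent-unless p<q λ q<ᵛp → <⇒≱ p<r (left-inversion-top p<q q<c q<ᵛp)
  cells zero (suc zero) p q _ (q<c , r≤q) p<q =
    ascent-unless p<q λ q<ᵛp → <⇒≱ (inversion-below-r (p<q , q<ᵛp , inj₁ q<c)) r≤q
  cells (suc zero) (suc zero) p q (c≤p , _) (_ , r≤q) p<q =
    ascent-unless p<q λ q<ᵛp → <⇒≱ (inversion-below-r (p<q , q<ᵛp , inj₂ c≤p)) r≤q
  cells (suc zero) zero p q (c≤p , _) (_ , q<r) p<q =
    descent-unless p<q λ p<ᵛq → <⇒≱ q<r (right-ascent-top p<q c≤p p<ᵛq)

  grid : InGrid2x2 M₄₂ π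
  grid = c , r , c≤n , r≤n , cells

lemma4p2 : (n : ℕ) (π : Perm n) → InAv2143-4312 π → InGrid2x2 M₄₂ π
lemma4p2 n π (avoids-2143 , avoids-4312) = Avoiding.grid π avoids-2143 avoids-4312
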